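{- Let $w$ be a strictly decreasing word over $A$ and let $D$ be the set of columns fixed by $w$ (i.e. $w\cdot\delta=\delta$). For $\delta\in D$ let $\Gamma_\delta=\{\gamma\in\mathcal C(A)\mid \gamma\geq\delta \text{ and for all } \delta'\in D,\ \gamma\geq\delta'\Rightarrow\delta'\leq\delta\}$. Then (i) $\Gamma_\delta=\{\gamma\in\mathcal C(A)\mid w\cdot\gamma=\delta\}$; (ii) for every column $\gamma$, $w\cdot\gamma$ is the maximum, in the poset $D$, of the columns of $D$ that are $\leq\gamma$; (iii) each $\Gamma_\delta$ is an interval of the poset $(\mathcal C(A),\leq)$.
   Context: $A$ is a finite totally ordered alphabet and $\mathcal C(A)$ the set of columns, i.e. subsets of $A$, each identified with the strictly decreasing word of its elements. For a column $\gamma$ and a letter $x$: if $x>y$ for all $y\in\gamma$, $x\cdot\gamma=\gamma\cup\{x\}$; otherwise with $y$ the smallest element of $\gamma$ with $y\geq x$, $x\cdot\gamma=(\gamma\setminus\{y\})\cup\{x\}$; this extends to a left action of $A^*$ on columns by $(uv)\cdot\gamma=u\cdot(v\cdot\gamma)$. Order on columns: $\gamma_1\leq\gamma_2$ iff $|\gamma_2|\leq|\gamma_1|$ and for each $i\leq|\gamma_2|$ the $i$-th smallest element of $\gamma_1$ is $\leq$ the $i$-th smallest element of $\gamma_2$ (for nonempty columns: $\gamma_1,\gamma_2$ can be the two columns, left to right, of a semistandard tableau; the empty column is the maximum). -}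

module Defs where

open import Data.Nat using (ℕ)
open import Data.Fin using (Fin; zero; suc; _≤_; _<_; _≤?_)
open import Data.Fin.Subset using (Subset; _-_; _∪_; ⁅_⁆)
open import Data.Vec using ([]; _∷_)
open import Data.List using (List; []; _∷_; map; foldr)
open import Data.List.Relation.Unary.Linked using (Linked)
open import Data.Maybe using (Maybe; just; nothing)
open import Data.Bool using (true; false)
open import Data.Product using (_×_)
open import Data.Empty using (⊥)
open import Data.Unit using (⊤)
open import Relation.Nullary using (yes; no)
open import Relation.Binary.PropositionalEquality using (_≡_)

-- The alphabet A is Fin n with its usual total order.
-- A column is a subset of A.
Column : ℕ → Set
Column n = Subset n

elems : ∀ {n} → Column n → List (Fin n)
elems [] = []
elems (true  ∷ p) = zero ∷ map suc (elems p)
elems (false ∷ p) = map suc (elems p)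

firstGE : ∀ {n} → Fin n → List (Fin n) → Maybe (Fin n)
firstGE x [] = nothing
firstGE x (y ∷ ys) with x ≤? y
... | yes _ = just y
... | no  _ = firstGE x ys

act : ∀ {n} → Fin n → Column n → Column n
act x γ with firstGE x (elems γ)
... | nothing = γ ∪ ⁅ x ⁆
... | just y  = (γ - y) ∪ ⁅ x ⁆

actW : ∀ {n} → List (Fin n) → Column n → Column n
actW w γ = foldr act γ w

StrictlyDecreasing : ∀ {n} → List (Fin n) → Set
StrictlyDecreasing {n} w = Linked (λ (a b : Fin n) → b < a) w

LeList : ∀ {n} → List (Fin n) → List (Fin n) → Set
LeList _ [] = ⊤
LeList [] (_ ∷ _) = ⊥
LeList (x ∷ xs) (y ∷ ys) = (x ≤ y) × LeList xs ys

_≤ᶜ_ : ∀ {n} → Column n → Column n → Set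
γ₁ ≤ᶜ γ₂ = LeList (elems γ₁) (elems γ₂)

Fixed : ∀ {n} → List (Fin n) → Column n → Set
Fixed w δ = actW w δ ≡ δ

InΓ : ∀ {n} → List (Fin n) → Column n → Column n → Set
InΓ {n} w δ γ = (δ ≤ᶜ γ) × (∀ (δ' : Column n) → Fixed w δ' → δ' ≤ᶜ γ → δ' ≤ᶜ δ)

-- A strictly decreasing word w with letter set E acts on a column in a single bottom-up sweep: every
-- letter of E ends up in the column, and each letter missing from γ deletes the next element of γ
-- outside E that has not already been deleted. In this description the columns fixed by w are exactly
-- those containing E, and w · γ is the greatest of them below γ, which is (ii); (i) follows from (ii) by
-- antisymmetry. The fibre over a fixed δ is the interval from δ to the column obtained by undoing the
-- sweep while pushing every deletion as high as the positions outside E and δ allow, which is (iii).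

module Submission where

open import Data.Bool using (Bool; true; false; if_then_else_)
open import Data.Bool.Properties using (∨-identityʳ)
open import Data.Empty using (⊥)
open import Data.Fin using (Fin; zero; suc; _≤?_)
import Data.Fin as Fin
open import Data.Fin.Properties using () renaming (≤-trans to ≤ᶠ-trans)
open import Data.Fin.Subset using (Subset; _⊆_; _∪_; _─_; _-_; ⁅_⁆) renaming (⊥ to ∅)
open import Data.Fin.Subset.Properties using (∪-identityʳ; p─⊥≡p; drop-∷-⊆; ⊥⊆)
open import Data.List using (List; []; _∷_; map; drop; head)
open import Data.List.Properties using (head-map)
open import Data.List.Relation.Unary.Linked using (_∷_)
import Data.List.Relation.Unary.Linked as Linked
open import Data.Maybe using (just; nothing; maybe′)
import Data.Maybe as Maybe
open import Data.Nat using (ℕ; zero; suc; _+_; _≟_; z≤n; s≤s; s≤s⁻¹)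
open import Data.Nat.Properties using (+-suc; +-identityʳ; suc-injective; <⇒≤)
open import Data.Product using (_×_; _,_; proj₁; proj₂; ∃₂)
open import Data.Unit using (⊤; tt)
open import Data.Vec using ([]; _∷_; _[_]≔_; here; there)
open import Function.Bundles using (_⇔_; mk⇔; Equivalence)
open import Relation.Binary.PropositionalEquality using (_≡_; refl; sym; trans; cong; cong₂; subst; module ≡-Reasoning)
open ≡-Reasoning
open import Relation.Nullary using (Dec; yes; no; does; ¬_; contradiction)

open import Defs

private variable
  n : ℕ

act-unfold : ∀ (x : Fin n) γ → act x γ ≡ maybe′ (γ -_) γ (firstGE x (elems γ)) ∪ ⁅ x ⁆
act-unfold x γ with firstGE x (elems γ)
... | nothing = refl
... | just y  = refl

firstGE-zero : ∀ (l : List (Fin (suc n))) → firstGE zero l ≡ head l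
firstGE-zero []      = refl
firstGE-zero {n} (y ∷ l) with Fin.zero {n} ≤? y
... | yes _   = refl
... | no 0≰y  = contradiction z≤n 0≰y

firstGE-map-suc : ∀ (x : Fin n) l → firstGE (suc x) (map suc l) ≡ Maybe.map suc (firstGE x l)
firstGE-map-suc x []      = refl
firstGE-map-suc x (y ∷ l) with x ≤? y | suc x ≤? suc y
... | yes _   | yes _   = refl
... | no _    | no _    = firstGE-map-suc x l
... | yes x≤y | no x≰y  = contradiction (s≤s x≤y) x≰y
... | no x≰y  | yes x≤y = contradiction (s≤s⁻¹ x≤y) x≰y

firstGE-suc-elems : ∀ (x : Fin n) b p →
  firstGE (suc x) (elems (b ∷ p)) ≡ Maybe.map suc (firstGE x (elems p))
firstGE-suc-elems x false p = firstGE-map-suc x (elems p)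
firstGE-suc-elems {n} x true  p with suc x ≤? Fin.zero {n}
... | no _ = firstGE-map-suc x (elems p)

remove-map-suc : ∀ b (p : Subset n) m →
  maybe′ ((b ∷ p) -_) (b ∷ p) (Maybe.map suc m) ≡ b ∷ maybe′ (p -_) p m
remove-map-suc b p nothing  = refl
remove-map-suc b p (just y) = refl

act-suc : ∀ (x : Fin n) b p → act (suc x) (b ∷ p) ≡ b ∷ act x p
act-suc x b p
  rewrite act-unfold (suc x) (b ∷ p) | firstGE-suc-elems x b p | remove-map-suc b p (firstGE x (elems p))
  = cong₂ _∷_ (∨-identityʳ b) (sym (act-unfold x p))

act-zero-∈ : ∀ (p : Subset n) → act zero (true ∷ p) ≡ true ∷ p
act-zero-∈ p rewrite act-unfold zero (true ∷ p) | firstGE-zero (zero ∷ map suc (elems p)) =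
  cong (true ∷_) (trans (∪-identityʳ (p ─ ∅)) (p─⊥≡p p))

removeMin : Subset n → Subset n
removeMin []          = []
removeMin (true  ∷ p) = false ∷ p
removeMin (false ∷ p) = false ∷ removeMin p

removeMin-≡ : ∀ (p : Subset n) → removeMin p ≡ maybe′ (p -_) p (head (elems p))
removeMin-≡ []          = refl
removeMin-≡ (true  ∷ p) = cong (false ∷_) (sym (p─⊥≡p p))
removeMin-≡ (false ∷ p) = begin
  false ∷ removeMin p                                                ≡⟨ cong (false ∷_) (removeMin-≡ p) ⟩
  false ∷ maybe′ (p -_) p (head (elems p))                           ≡⟨ remove-map-suc false p (head (elems p)) ⟨
  maybe′ ((false ∷ p) -_) (false ∷ p) (Maybe.map suc (head (elems p))) ≡⟨ cong (maybe′ _ _) (head-map (elems p)) ⟨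
  maybe′ ((false ∷ p) -_) (false ∷ p) (head (map suc (elems p)))       ∎

act-zero-∉ : ∀ (p : Subset n) → act zero (false ∷ p) ≡ true ∷ removeMin p
act-zero-∉ p = begin
  act zero (false ∷ p)                                                   ≡⟨ act-unfold zero (false ∷ p) ⟩
  maybe′ ((false ∷ p) -_) (false ∷ p) (firstGE zero (map suc (elems p))) ∪ ⁅ zero ⁆
    ≡⟨ cong (λ m → maybe′ ((false ∷ p) -_) (false ∷ p) m ∪ ⁅ zero ⁆)
            (trans (firstGE-zero (map suc (elems p))) (head-map (elems p))) ⟩
  maybe′ ((false ∷ p) -_) (false ∷ p) (Maybe.map suc (head (elems p))) ∪ ⁅ zero ⁆
    ≡⟨ cong (_∪ ⁅ zero ⁆) (remove-map-suc false p (head (elems p))) ⟩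
  true ∷ (maybe′ (p -_) p (head (elems p)) ∪ ∅)                          ≡⟨ cong (true ∷_) (∪-identityʳ _) ⟩
  true ∷ maybe′ (p -_) p (head (elems p))                                ≡⟨ cong (true ∷_) (removeMin-≡ p) ⟨
  true ∷ removeMin p                                                     ∎

-- s counts the letters of E, already passed, that are missing from γ and have not yet deleted anything.
step : ℕ → Bool → Bool → Bool × ℕ
step s       true  true  = true  , s
step s       true  false = true  , suc s
step s       false false = false , s
step zero    false true  = true  , zero
step (suc s) false true  = false , s

sweep : ℕ → Subset n → Subset n → Subset n
sweep s []      []      = []
sweep s (e ∷ E) (c ∷ γ) = proj₁ (step s e c) ∷ sweep (proj₂ (step s e c)) E γ

⊆-sweep : ∀ s (E γ : Subset n) → E ⊆ sweep s E γ
⊆-sweep s (true ∷ E) (true  ∷ γ) here         = here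
⊆-sweep s (true ∷ E) (false ∷ γ) here         = here
⊆-sweep s (e    ∷ E) (c     ∷ γ) (there x∈E) = there (⊆-sweep (proj₂ (step s e c)) E γ x∈E)

sweep-id : ∀ (E δ : Subset n) → E ⊆ δ → sweep 0 E δ ≡ δ
sweep-id []          []          _   = refl
sweep-id (true  ∷ E) (true  ∷ δ) E⊆δ = cong (true ∷_) (sweep-id E δ (drop-∷-⊆ E⊆δ))
sweep-id (true  ∷ E) (false ∷ δ) E⊆δ with E⊆δ here
... | ()
sweep-id (false ∷ E) (true  ∷ δ) E⊆δ = cong (true ∷_) (sweep-id E δ (drop-∷-⊆ E⊆δ))
sweep-id (false ∷ E) (false ∷ δ) E⊆δ = cong (false ∷_) (sweep-id E δ (drop-∷-⊆ E⊆δ))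

letters : List (Fin n) → Subset n
letters []      = ∅
letters (x ∷ w) = letters w [ x ]≔ true

Below : Fin n → Subset n → Set
Below zero    (e ∷ E) = e ≡ false × E ≡ ∅
Below (suc x) (_ ∷ E) = Below x E

∅-below : ∀ (x : Fin n) → Below x ∅
∅-below zero    = refl , refl
∅-below (suc x) = ∅-below x

below-mono : ∀ (x y : Fin n) E → y Fin.≤ x → Below y E → Below x E
below-mono zero    zero    E       _   below         = below
below-mono (suc x) zero    (_ ∷ E) _   (refl , refl) = ∅-below x
below-mono (suc x) (suc y) (_ ∷ E) y≤x below         = below-mono x y E (s≤s⁻¹ y≤x) below

below-set : ∀ (x y : Fin n) E → y Fin.< x → Below x E → Below x (E [ y ]≔ true)
below-set (suc x) zero    (_ ∷ E) _   below = below
below-set (suc x) (suc y) (_ ∷ E) y<x below = below-set x y E (s≤s⁻¹ y<x) below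

decreasing⇒below : ∀ (x : Fin n) w → StrictlyDecreasing (x ∷ w) → Below x (letters w)
decreasing⇒below x []      _           = ∅-below x
decreasing⇒below x (y ∷ w) (y<x ∷ w↓) =
  below-set x y (letters w) y<x (below-mono x y (letters w) (<⇒≤ y<x) (decreasing⇒below y w w↓))

removeMin-sweep-∅ : ∀ s (γ : Subset n) → removeMin (sweep s ∅ γ) ≡ sweep (suc s) ∅ γ
removeMin-sweep-∅ s       []          = refl
removeMin-sweep-∅ zero    (true  ∷ γ) = refl
removeMin-sweep-∅ (suc s) (true  ∷ γ) = cong (false ∷_) (removeMin-sweep-∅ s γ)
removeMin-sweep-∅ s       (false ∷ γ) = cong (false ∷_) (removeMin-sweep-∅ s γ)

act-sweep : ∀ (x : Fin n) s E γ → Below x E → act x (sweep s E γ) ≡ sweep s (E [ x ]≔ true) γ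
act-sweep zero    zero    (_ ∷ _) (true  ∷ γ) (refl , refl) = act-zero-∈ (sweep 0 ∅ γ)
act-sweep zero    (suc s) (_ ∷ _) (true  ∷ γ) (refl , refl) =
  trans (act-zero-∉ (sweep s ∅ γ)) (cong (true ∷_) (removeMin-sweep-∅ s γ))
act-sweep zero    s       (_ ∷ _) (false ∷ γ) (refl , refl) =
  trans (act-zero-∉ (sweep s ∅ γ)) (cong (true ∷_) (removeMin-sweep-∅ s γ))
act-sweep (suc x) s       (e ∷ E) (c ∷ γ)     below         =
  trans (act-suc x _ _) (cong (_ ∷_) (act-sweep x (proj₂ (step s e c)) E γ below))

actW-sweep : ∀ (w : List (Fin n)) → StrictlyDecreasing w → ∀ γ → actW w γ ≡ sweep 0 (letters w) γ
actW-sweep []      _  γ = sym (sweep-id ∅ γ ⊥⊆)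
actW-sweep (x ∷ w) w↓ γ = begin
  act x (actW w γ)               ≡⟨ cong (act x) (actW-sweep w (Linked.tail w↓) γ) ⟩
  act x (sweep 0 (letters w) γ)  ≡⟨ act-sweep x 0 (letters w) γ (decreasing⇒below x w w↓) ⟩
  sweep 0 (letters (x ∷ w)) γ    ∎

-- p ≤[ d ] q compares p with q deprived of its d smallest elements (≤[]⇒LeList, LeList⇒≤[]).
infix 4 _≤[_]_

_≤[_]_ : Subset n → ℕ → Subset n → Set
[]          ≤[ d     ] []          = ⊤
(true  ∷ p) ≤[ d     ] (true  ∷ q) = p ≤[ d ] q
(true  ∷ p) ≤[ d     ] (false ∷ q) = p ≤[ suc d ] q
(false ∷ p) ≤[ d     ] (false ∷ q) = p ≤[ d ] q
(false ∷ p) ≤[ zero  ] (true  ∷ q) = ⊥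
(false ∷ p) ≤[ suc d ] (true  ∷ q) = p ≤[ d ] q

LeList-map-suc⁺ : ∀ (xs ys : List (Fin n)) → LeList xs ys → LeList (map suc xs) (map suc ys)
LeList-map-suc⁺ xs       []       _           = tt
LeList-map-suc⁺ (x ∷ xs) (y ∷ ys) (x≤y , rest) = s≤s x≤y , LeList-map-suc⁺ xs ys rest

LeList-map-suc⁻ : ∀ (xs ys : List (Fin n)) → LeList (map suc xs) (map suc ys) → LeList xs ys
LeList-map-suc⁻ xs       []       _           = tt
LeList-map-suc⁻ (x ∷ xs) (y ∷ ys) (x≤y , rest) = s≤s⁻¹ x≤y , LeList-map-suc⁻ xs ys rest

LeList-map-suc-drop⁺ : ∀ d (xs ys : List (Fin n)) →
  LeList xs (drop d ys) → LeList (map suc xs) (drop d (map suc ys))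
LeList-map-suc-drop⁺ zero    xs ys       = LeList-map-suc⁺ xs ys
LeList-map-suc-drop⁺ (suc d) xs []       = λ _ → tt
LeList-map-suc-drop⁺ (suc d) xs (y ∷ ys) = LeList-map-suc-drop⁺ d xs ys

LeList-map-suc-drop⁻ : ∀ d (xs ys : List (Fin n)) →
  LeList (map suc xs) (drop d (map suc ys)) → LeList xs (drop d ys)
LeList-map-suc-drop⁻ zero    xs ys       = LeList-map-suc⁻ xs ys
LeList-map-suc-drop⁻ (suc d) xs []       = λ _ → tt
LeList-map-suc-drop⁻ (suc d) xs (y ∷ ys) = LeList-map-suc-drop⁻ d xs ys

LeList-zero-drop⁺ : ∀ d (xs ys : List (Fin n)) →
  LeList xs (drop (suc d) ys) → LeList (zero ∷ map suc xs) (drop d (map suc ys))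
LeList-zero-drop⁺ zero    xs []       _ = tt
LeList-zero-drop⁺ zero    xs (y ∷ ys) h = z≤n , LeList-map-suc⁺ xs ys h
LeList-zero-drop⁺ (suc d) xs []       _ = tt
LeList-zero-drop⁺ (suc d) xs (y ∷ ys) h = LeList-zero-drop⁺ d xs ys h

LeList-zero-drop⁻ : ∀ d (xs ys : List (Fin n)) →
  LeList (zero ∷ map suc xs) (drop d (map suc ys)) → LeList xs (drop (suc d) ys)
LeList-zero-drop⁻ zero    xs []       _       = tt
LeList-zero-drop⁻ zero    xs (y ∷ ys) (_ , h) = LeList-map-suc⁻ xs ys h
LeList-zero-drop⁻ (suc d) xs []       _       = tt
LeList-zero-drop⁻ (suc d) xs (y ∷ ys) h       = LeList-zero-drop⁻ d xs ys h

LeList-map-suc-zero : ∀ (xs : List (Fin n)) ys → ¬ LeList (map suc xs) (zero ∷ ys)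
LeList-map-suc-zero []      ys ()
LeList-map-suc-zero (x ∷ xs) ys (() , _)

≤[]⇒LeList : ∀ d (p q : Subset n) → p ≤[ d ] q → LeList (elems p) (drop d (elems q))
≤[]⇒LeList zero    []          []          _ = tt
≤[]⇒LeList (suc d) []          []          _ = tt
≤[]⇒LeList zero    (true  ∷ p) (true  ∷ q) h = z≤n , LeList-map-suc⁺ _ _ (≤[]⇒LeList 0 p q h)
≤[]⇒LeList (suc d) (true  ∷ p) (true  ∷ q) h = LeList-zero-drop⁺ d _ _ (≤[]⇒LeList (suc d) p q h)
≤[]⇒LeList d       (true  ∷ p) (false ∷ q) h = LeList-zero-drop⁺ d _ _ (≤[]⇒LeList (suc d) p q h)
≤[]⇒LeList (suc d) (false ∷ p) (true  ∷ q) h = LeList-map-suc-drop⁺ d _ _ (≤[]⇒LeList d p q h)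
≤[]⇒LeList d       (false ∷ p) (false ∷ q) h = LeList-map-suc-drop⁺ d _ _ (≤[]⇒LeList d p q h)

LeList⇒≤[] : ∀ d (p q : Subset n) → LeList (elems p) (drop d (elems q)) → p ≤[ d ] q
LeList⇒≤[] zero    []          []          _       = tt
LeList⇒≤[] (suc d) []          []          _       = tt
LeList⇒≤[] zero    (true  ∷ p) (true  ∷ q) (_ , h) = LeList⇒≤[] 0 p q (LeList-map-suc⁻ _ _ h)
LeList⇒≤[] (suc d) (true  ∷ p) (true  ∷ q) h       = LeList⇒≤[] (suc d) p q (LeList-zero-drop⁻ d _ _ h)
LeList⇒≤[] d       (true  ∷ p) (false ∷ q) h       = LeList⇒≤[] (suc d) p q (LeList-zero-drop⁻ d _ _ h)
LeList⇒≤[] zero    (false ∷ p) (true  ∷ q) h       = LeList-map-suc-zero (elems p) _ h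
LeList⇒≤[] (suc d) (false ∷ p) (true  ∷ q) h       = LeList⇒≤[] d p q (LeList-map-suc-drop⁻ d _ _ h)
LeList⇒≤[] d       (false ∷ p) (false ∷ q) h       = LeList⇒≤[] d p q (LeList-map-suc-drop⁻ d _ _ h)

≤[0]-antisym : ∀ (p q : Subset n) → p ≤[ 0 ] q → q ≤[ 0 ] p → p ≡ q
≤[0]-antisym []          []          _   _   = refl
≤[0]-antisym (true  ∷ p) (true  ∷ q) p≤q q≤p = cong (true ∷_) (≤[0]-antisym p q p≤q q≤p)
≤[0]-antisym (false ∷ p) (false ∷ q) p≤q q≤p = cong (false ∷_) (≤[0]-antisym p q p≤q q≤p)
≤[0]-antisym (true  ∷ p) (false ∷ q) _   ()
≤[0]-antisym (false ∷ p) (true  ∷ q) ()  _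

LeList-trans : ∀ (xs ys zs : List (Fin n)) → LeList xs ys → LeList ys zs → LeList xs zs
LeList-trans xs       ys       []       _            _            = tt
LeList-trans (x ∷ xs) (y ∷ ys) (z ∷ zs) (x≤y , xs≤ys) (y≤z , ys≤zs) =
  ≤ᶠ-trans x≤y y≤z , LeList-trans xs ys zs xs≤ys ys≤zs

≤ᶜ-trans : ∀ (γ₁ γ₂ γ₃ : Column n) → γ₁ ≤ᶜ γ₂ → γ₂ ≤ᶜ γ₃ → γ₁ ≤ᶜ γ₃
≤ᶜ-trans γ₁ γ₂ γ₃ = LeList-trans (elems γ₁) (elems γ₂) (elems γ₃)

≤ᶜ-antisym : ∀ (γ₁ γ₂ : Column n) → γ₁ ≤ᶜ γ₂ → γ₂ ≤ᶜ γ₁ → γ₁ ≡ γ₂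
≤ᶜ-antisym γ₁ γ₂ γ₁≤γ₂ γ₂≤γ₁ = ≤[0]-antisym γ₁ γ₂ (LeList⇒≤[] 0 γ₁ γ₂ γ₁≤γ₂) (LeList⇒≤[] 0 γ₂ γ₁ γ₂≤γ₁)

sweep-≤ : ∀ s (E γ : Subset n) → sweep s E γ ≤[ s ] γ
sweep-≤ s       []          []          = tt
sweep-≤ s       (true  ∷ E) (true  ∷ γ) = sweep-≤ s E γ
sweep-≤ s       (true  ∷ E) (false ∷ γ) = sweep-≤ (suc s) E γ
sweep-≤ s       (false ∷ E) (false ∷ γ) = sweep-≤ s E γ
sweep-≤ zero    (false ∷ E) (true  ∷ γ) = sweep-≤ zero E γ
sweep-≤ (suc s) (false ∷ E) (true  ∷ γ) = sweep-≤ s E γ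

sweep-greatest : ∀ s k (E δ γ : Subset n) → E ⊆ δ → δ ≤[ s + k ] γ → δ ≤[ k ] sweep s E γ
sweep-greatest s k [] [] [] _ _ = tt
sweep-greatest s k (true ∷ E) (false ∷ δ) γ E⊆δ _ with E⊆δ here
... | ()
sweep-greatest s k (true ∷ E) (true ∷ δ) (true ∷ γ) E⊆δ δ≤γ =
  sweep-greatest s k E δ γ (drop-∷-⊆ E⊆δ) δ≤γ
sweep-greatest s k (true ∷ E) (true ∷ δ) (false ∷ γ) E⊆δ δ≤γ =
  sweep-greatest (suc s) k E δ γ (drop-∷-⊆ E⊆δ) δ≤γ
sweep-greatest s k (false ∷ E) (true ∷ δ) (false ∷ γ) E⊆δ δ≤γ =
  sweep-greatest s (suc k) E δ γ (drop-∷-⊆ E⊆δ) (subst (λ d → δ ≤[ d ] γ) (sym (+-suc s k)) δ≤γ)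
sweep-greatest s k (false ∷ E) (false ∷ δ) (false ∷ γ) E⊆δ δ≤γ =
  sweep-greatest s k E δ γ (drop-∷-⊆ E⊆δ) δ≤γ
sweep-greatest zero k (false ∷ E) (true ∷ δ) (true ∷ γ) E⊆δ δ≤γ =
  sweep-greatest zero k E δ γ (drop-∷-⊆ E⊆δ) δ≤γ
sweep-greatest zero (suc k) (false ∷ E) (false ∷ δ) (true ∷ γ) E⊆δ δ≤γ =
  sweep-greatest zero k E δ γ (drop-∷-⊆ E⊆δ) δ≤γ
sweep-greatest (suc s) k (false ∷ E) (true ∷ δ) (true ∷ γ) E⊆δ δ≤γ =
  sweep-greatest s (suc k) E δ γ (drop-∷-⊆ E⊆δ) (subst (λ d → δ ≤[ d ] γ) (sym (+-suc s k)) δ≤γ)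
sweep-greatest (suc s) k (false ∷ E) (false ∷ δ) (true ∷ γ) E⊆δ δ≤γ =
  sweep-greatest s k E δ γ (drop-∷-⊆ E⊆δ) δ≤γ

-- If δ has an element outside E, at least s positions in neither E nor δ come before the first one,
-- so s pending deletions can be carried out without deleting anything from δ.
Absorbs : ℕ → Subset n → Subset n → Set
Absorbs s       []          []          = ⊤
Absorbs s       (true  ∷ E) (_     ∷ δ) = Absorbs s E δ
Absorbs s       (false ∷ E) (true  ∷ δ) = s ≡ 0
Absorbs zero    (false ∷ E) (false ∷ δ) = ⊤
Absorbs (suc s) (false ∷ E) (false ∷ δ) = Absorbs s E δ

absorbs? : ∀ s (E δ : Subset n) → Dec (Absorbs s E δ)
absorbs? s       []          []          = yes tt
absorbs? s       (true  ∷ E) (_     ∷ δ) = absorbs? s E δ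
absorbs? s       (false ∷ E) (true  ∷ δ) = s ≟ 0
absorbs? zero    (false ∷ E) (false ∷ δ) = yes tt
absorbs? (suc s) (false ∷ E) (false ∷ δ) = absorbs? s E δ

absorbs-zero : ∀ (E δ : Subset n) → Absorbs 0 E δ
absorbs-zero []          []          = tt
absorbs-zero (true  ∷ E) (_     ∷ δ) = absorbs-zero E δ
absorbs-zero (false ∷ E) (true  ∷ δ) = refl
absorbs-zero (false ∷ E) (false ∷ δ) = tt

absorbs-pred : ∀ s (E δ : Subset n) → Absorbs (suc s) E δ → Absorbs s E δ
absorbs-pred s       []          []          _ = tt
absorbs-pred s       (true  ∷ E) (_     ∷ δ) a = absorbs-pred s E δ a
absorbs-pred zero    (false ∷ E) (false ∷ δ) _ = tt
absorbs-pred (suc s) (false ∷ E) (false ∷ δ) a = absorbs-pred s E δ a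

absorbs-sweep : ∀ s (E γ : Subset n) → Absorbs s E (sweep s E γ)
absorbs-sweep s       []          []          = tt
absorbs-sweep s       (true  ∷ E) (true  ∷ γ) = absorbs-sweep s E γ
absorbs-sweep s       (true  ∷ E) (false ∷ γ) = absorbs-pred s E _ (absorbs-sweep (suc s) E γ)
absorbs-sweep zero    (false ∷ E) (false ∷ γ) = tt
absorbs-sweep (suc s) (false ∷ E) (false ∷ γ) = absorbs-pred s E _ (absorbs-sweep (suc s) E γ)
absorbs-sweep zero    (false ∷ E) (true  ∷ γ) = refl
absorbs-sweep (suc s) (false ∷ E) (true  ∷ γ) = absorbs-sweep s E γ

-- The greatest column in the fibre over δ: with s deletions pending, a letter of E is left out of the
-- column, and a position outside E and δ is left empty, whenever the positions above can still absorb
-- the deletions then pending.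
fibreTop : ℕ → Subset n → Subset n → Subset n
fibreTop s       []          []          = []
fibreTop s       (true  ∷ E) (_     ∷ δ) =
  if does (absorbs? (suc s) E δ) then false ∷ fibreTop (suc s) E δ else true ∷ fibreTop s E δ
fibreTop s       (false ∷ E) (true  ∷ δ) = true ∷ fibreTop 0 E δ
fibreTop zero    (false ∷ E) (false ∷ δ) = false ∷ fibreTop 0 E δ
fibreTop (suc s) (false ∷ E) (false ∷ δ) =
  if does (absorbs? (suc s) E δ) then false ∷ fibreTop (suc s) E δ else true ∷ fibreTop s E δ

sweep-fibreTop : ∀ s (E δ : Subset n) → E ⊆ δ → Absorbs s E δ → sweep s E (fibreTop s E δ) ≡ δ
sweep-fibreTop s []          []          _   _ = refl
sweep-fibreTop s (true  ∷ E) (false ∷ δ) E⊆δ _ with E⊆δ here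
... | ()
sweep-fibreTop s (true  ∷ E) (true  ∷ δ) E⊆δ a with absorbs? (suc s) E δ
... | yes a′ = cong (true ∷_) (sweep-fibreTop (suc s) E δ (drop-∷-⊆ E⊆δ) a′)
... | no _   = cong (true ∷_) (sweep-fibreTop s E δ (drop-∷-⊆ E⊆δ) a)
sweep-fibreTop .zero (false ∷ E) (true  ∷ δ) E⊆δ refl =
  cong (true ∷_) (sweep-fibreTop 0 E δ (drop-∷-⊆ E⊆δ) (absorbs-zero E δ))
sweep-fibreTop zero    (false ∷ E) (false ∷ δ) E⊆δ _ =
  cong (false ∷_) (sweep-fibreTop 0 E δ (drop-∷-⊆ E⊆δ) (absorbs-zero E δ))
sweep-fibreTop (suc s) (false ∷ E) (false ∷ δ) E⊆δ a with absorbs? (suc s) E δ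
... | yes a′ = cong (false ∷_) (sweep-fibreTop (suc s) E δ (drop-∷-⊆ E⊆δ) a′)
... | no _   = cong (false ∷_) (sweep-fibreTop s E δ (drop-∷-⊆ E⊆δ) a)

-- fibreTop may carry more pending deletions than the sweep of γ; each extra one puts γ one element ahead.
≤[]-fibreTop-sweep : ∀ s k t (E γ : Subset n) → t ≡ s + k → Absorbs t E (sweep s E γ) →
  γ ≤[ k ] fibreTop t E (sweep s E γ)
≤[]-fibreTop-sweep s k t [] [] _ _ = tt
≤[]-fibreTop-sweep s k t (true ∷ E) (true ∷ γ) t≡s+k a with absorbs? (suc t) E (sweep s E γ)
... | yes a′ = ≤[]-fibreTop-sweep s (suc k) (suc t) E γ (trans (cong suc t≡s+k) (sym (+-suc s k))) a′
... | no _   = ≤[]-fibreTop-sweep s k t E γ t≡s+k a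
≤[]-fibreTop-sweep s k t (true ∷ E) (false ∷ γ) t≡s+k a with absorbs? (suc t) E (sweep (suc s) E γ)
... | yes a′ = ≤[]-fibreTop-sweep (suc s) k (suc t) E γ (cong suc t≡s+k) a′
≤[]-fibreTop-sweep s zero t (true ∷ E) (false ∷ γ) t≡s+k a | no ¬a′ =
  ¬a′ (subst (λ u → Absorbs (suc u) E (sweep (suc s) E γ)) (sym (trans t≡s+k (+-identityʳ s)))
             (absorbs-sweep (suc s) E γ))
≤[]-fibreTop-sweep s (suc k) t (true ∷ E) (false ∷ γ) t≡s+k a | no _ =
  ≤[]-fibreTop-sweep (suc s) k t E γ (trans t≡s+k (+-suc s k)) a
≤[]-fibreTop-sweep s k zero (false ∷ E) (false ∷ γ) t≡s+k _ =
  ≤[]-fibreTop-sweep s k 0 E γ t≡s+k (absorbs-zero E (sweep s E γ))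
≤[]-fibreTop-sweep s k (suc t) (false ∷ E) (false ∷ γ) t≡s+k a with absorbs? (suc t) E (sweep s E γ)
... | yes a′ = ≤[]-fibreTop-sweep s k (suc t) E γ t≡s+k a′
≤[]-fibreTop-sweep s zero (suc t) (false ∷ E) (false ∷ γ) t≡s+k a | no ¬a′ =
  ¬a′ (subst (λ u → Absorbs u E (sweep s E γ)) (sym (trans t≡s+k (+-identityʳ s)))
             (absorbs-sweep s E γ))
≤[]-fibreTop-sweep s (suc k) (suc t) (false ∷ E) (false ∷ γ) t≡s+k a | no _ =
  ≤[]-fibreTop-sweep s k t E γ (suc-injective (trans t≡s+k (+-suc s k))) a
≤[]-fibreTop-sweep zero k t (false ∷ E) (true ∷ γ) t≡k t≡0 =
  ≤[]-fibreTop-sweep 0 k 0 E γ (trans (sym t≡0) t≡k) (absorbs-zero E (sweep 0 E γ))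
≤[]-fibreTop-sweep (suc s) k (suc t) (false ∷ E) (true ∷ γ) t≡s+k a with absorbs? (suc t) E (sweep s E γ)
... | yes a′ = ≤[]-fibreTop-sweep s (suc k) (suc t) E γ (trans t≡s+k (sym (+-suc s k))) a′
... | no _   = ≤[]-fibreTop-sweep s k t E γ (suc-injective t≡s+k) a

module _ {n} {w : List (Fin n)} (w↓ : StrictlyDecreasing w) where

  ⊆-actW : ∀ γ → letters w ⊆ actW w γ
  ⊆-actW γ = subst (letters w ⊆_) (sym (actW-sweep w w↓ γ)) (⊆-sweep 0 (letters w) γ)

  fixed⇒⊆ : ∀ {δ} → Fixed w δ → letters w ⊆ δ
  fixed⇒⊆ {δ} fixed = subst (letters w ⊆_) fixed (⊆-actW δ)

  ⊆⇒fixed : ∀ {δ} → letters w ⊆ δ → Fixed w δ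
  ⊆⇒fixed {δ} E⊆δ = trans (actW-sweep w w↓ δ) (sweep-id (letters w) δ E⊆δ)

  actW-fixed : ∀ γ → Fixed w (actW w γ)
  actW-fixed γ = ⊆⇒fixed (⊆-actW γ)

  actW-≤ᶜ : ∀ γ → actW w γ ≤ᶜ γ
  actW-≤ᶜ γ = subst (_≤ᶜ γ) (sym (actW-sweep w w↓ γ))
    (≤[]⇒LeList 0 (sweep 0 (letters w) γ) γ (sweep-≤ 0 (letters w) γ))

  actW-greatest : ∀ {δ} γ → Fixed w δ → δ ≤ᶜ γ → δ ≤ᶜ actW w γ
  actW-greatest {δ} γ fixed δ≤γ = subst (δ ≤ᶜ_) (sym (actW-sweep w w↓ γ))
    (≤[]⇒LeList 0 δ (sweep 0 (letters w) γ)
      (sweep-greatest 0 0 (letters w) δ γ (fixed⇒⊆ fixed) (LeList⇒≤[] 0 δ γ δ≤γ)))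

  InΓ⇔actW≡ : ∀ {δ} → Fixed w δ → ∀ γ → InΓ w δ γ ⇔ (actW w γ ≡ δ)
  InΓ⇔actW≡ {δ} fixed γ = mk⇔ to from
    where
    to : InΓ w δ γ → actW w γ ≡ δ
    to (δ≤γ , maximal) =
      ≤ᶜ-antisym (actW w γ) δ (maximal (actW w γ) (actW-fixed γ) (actW-≤ᶜ γ)) (actW-greatest γ fixed δ≤γ)
    from : actW w γ ≡ δ → InΓ w δ γ
    from wγ≡δ = subst (_≤ᶜ γ) wγ≡δ (actW-≤ᶜ γ) ,
                λ δ′ fixed′ δ′≤γ → subst (δ′ ≤ᶜ_) wγ≡δ (actW-greatest γ fixed′ δ′≤γ)

  actW-fibreTop : ∀ {δ} → Fixed w δ → actW w (fibreTop 0 (letters w) δ) ≡ δ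
  actW-fibreTop {δ} fixed = trans (actW-sweep w w↓ _)
    (sweep-fibreTop 0 (letters w) δ (fixed⇒⊆ fixed) (absorbs-zero (letters w) δ))

  ≤ᶜ-fibreTop : ∀ {δ} γ → actW w γ ≡ δ → γ ≤ᶜ fibreTop 0 (letters w) δ
  ≤ᶜ-fibreTop {δ} γ wγ≡δ = ≤[]⇒LeList 0 γ (fibreTop 0 (letters w) δ)
    (subst (λ δ′ → γ ≤[ 0 ] fibreTop 0 (letters w) δ′) (trans (sym (actW-sweep w w↓ γ)) wγ≡δ)
      (≤[]-fibreTop-sweep 0 0 0 (letters w) γ refl (absorbs-zero (letters w) _)))

  InΓ⇔interval : ∀ {δ} → Fixed w δ → ∀ γ → InΓ w δ γ ⇔ ((δ ≤ᶜ γ) × (γ ≤ᶜ fibreTop 0 (letters w) δ))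
  InΓ⇔interval {δ} fixed γ = mk⇔ to from
    where
    to : InΓ w δ γ → (δ ≤ᶜ γ) × (γ ≤ᶜ fibreTop 0 (letters w) δ)
    to inΓ = proj₁ inΓ , ≤ᶜ-fibreTop γ (Equivalence.to (InΓ⇔actW≡ fixed γ) inΓ)
    from : (δ ≤ᶜ γ) × (γ ≤ᶜ fibreTop 0 (letters w) δ) → InΓ w δ γ
    from (δ≤γ , γ≤top) = Equivalence.from (InΓ⇔actW≡ fixed γ)
      (≤ᶜ-antisym (actW w γ) δ wγ≤δ (actW-greatest γ fixed δ≤γ))
      where
      wγ≤δ : actW w γ ≤ᶜ δ
      wγ≤δ = subst (actW w γ ≤ᶜ_) (actW-fibreTop fixed)
        (actW-greatest _ (actW-fixed γ)
          (≤ᶜ-trans (actW w γ) γ (fibreTop 0 (letters w) δ) (actW-≤ᶜ γ) γ≤top))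

proposition12p3 : (n : ℕ) (w : List (Fin n)) → StrictlyDecreasing w →
    (∀ (δ : Column n) → Fixed w δ → ∀ (γ : Column n) → InΓ w δ γ ⇔ (actW w γ ≡ δ))
    × (∀ (γ : Column n) → Fixed w (actW w γ) × (actW w γ ≤ᶜ γ)
         × (∀ (δ' : Column n) → Fixed w δ' → δ' ≤ᶜ γ → δ' ≤ᶜ actW w γ))
    × (∀ (δ : Column n) → Fixed w δ →
         ∃₂ λ (a b : Column n) → ∀ (γ : Column n) → InΓ w δ γ ⇔ ((a ≤ᶜ γ) × (γ ≤ᶜ b)))
proposition12p3 n w w↓ =
    (λ δ → InΓ⇔actW≡ w↓)
  , (λ γ → actW-fixed w↓ γ , actW-≤ᶜ w↓ γ , λ δ′ → actW-greatest w↓ γ)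
  , (λ δ fixed → δ , fibreTop 0 (letters w) δ , InΓ⇔interval w↓ fixed)
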